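{- Let $\Sigma$ be an implicational base over a finite set $U$ with closure system $\mathcal{C}$, and let $(U_1,U_2)$ be an acyclic split of $\Sigma$. Let $C_2,C_2'\in\mathcal{C}_2$ with $C_2'$ covering $C_2$ in $\mathcal{C}_2$, and let $C_1\in\mathcal{C}_1$ with $C_1\cup C_2\in\mathcal{C}$. Then $C_1\cup C_2'\in\mathcal{C}$ and $C_1\cup C_2'$ covers $C_1\cup C_2$ in $\mathcal{C}$.
   Context: An implication over $U$ is written $A \to b$ with $A \subseteq U$ nonempty and $b \in U$; an implicational base is a finite set of implications. $C\subseteq U$ satisfies $\Sigma$ if for all $A\to b\in\Sigma$, $A\subseteq C$ implies $b\in C$; the closure system of $\Sigma$ is the family of subsets satisfying $\Sigma$. For $X\subseteq U$, $\Sigma[X]=\{A\to b\in\Sigma: A\cup\{b\}\subseteq X\}$. A split of $\Sigma$ is a bipartition $(U_1,U_2)$ of $U$ into nonempty disjoint sets such that every premise is contained in $U_1$ or in $U_2$; $\Sigma[U_1,U_2]:=\Sigma\setminus(\Sigma[U_1]\cup\Sigma[U_2])$. The split is acyclic if $A\subseteq U_1$ for every $A\to b\in\Sigma[U_1,U_2]$. $\mathcal{C}_1$, $\mathcal{C}_2$ denote the closure systems of $\Sigma[U_1]$ (over $U_1$) and $\Sigma[U_2]$ (over $U_2$). In a family $\mathcal{F}$ of sets ordered by inclusion, $Y$ covers $X$ if $X\subsetneq Y$ and there is no $Z\in\mathcal{F}$ with $X\subsetneq Z\subsetneq Y$. -}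

module Defs where

open import Data.Nat using (ℕ)
open import Data.Fin using (Fin)
open import Data.Fin.Subset using (Subset; _∈_; _∉_; _⊆_; _∪_; ∁; Nonempty)
open import Data.List using (List)
open import Data.List.Membership.Propositional renaming (_∈_ to _∈ₗ_)
open import Data.Product using (_×_; Σ)
open import Data.Sum using (_⊎_)
open import Relation.Nullary using (¬_)

-- The ground set U is Fin n; subsets of U are Data.Fin.Subset.

record Implication (n : ℕ) : Set where
  constructor _⇒_[_]
  field
    premise    : Subset n
    conclusion : Fin n
    premise-ne : Nonempty premise
open Implication public

Base : ℕ → Set
Base n = List (Implication n)

SatisfiesImp : ∀ {n} → Subset n → Implication n → Set
SatisfiesImp C i = premise i ⊆ C → conclusion i ∈ C

Satisfies : ∀ {n} → Base n → Subset n → Set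
Satisfies Σ' C = ∀ {i} → i ∈ₗ Σ' → SatisfiesImp C i

InClosure : ∀ {n} → Base n → Subset n → Set
InClosure = Satisfies

InRestr : ∀ {n} → Base n → Subset n → Implication n → Set
InRestr Σ' X i = i ∈ₗ Σ' × premise i ⊆ X × conclusion i ∈ X

InClosureOn : ∀ {n} → Base n → Subset n → Subset n → Set
InClosureOn Σ' X C = C ⊆ X × (∀ {i} → InRestr Σ' X i → SatisfiesImp C i)

-- Split (U₁, U₂) with U₂ = complement of U₁; both nonempty, every premise
-- is contained in U₁ or in U₂.
IsSplit : ∀ {n} → Base n → Subset n → Set
IsSplit Σ' U₁ =
  Nonempty U₁ × Nonempty (∁ U₁) ×
  (∀ {i} → i ∈ₗ Σ' → premise i ⊆ U₁ ⊎ premise i ⊆ ∁ U₁)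

InCross : ∀ {n} → Base n → Subset n → Implication n → Set
InCross Σ' U₁ i = i ∈ₗ Σ' × ¬ InRestr Σ' U₁ i × ¬ InRestr Σ' (∁ U₁) i

IsAcyclicSplit : ∀ {n} → Base n → Subset n → Set
IsAcyclicSplit Σ' U₁ =
  IsSplit Σ' U₁ × (∀ {i} → InCross Σ' U₁ i → premise i ⊆ U₁)

_⊂_ : ∀ {n} → Subset n → Subset n → Set
X ⊂ Y = X ⊆ Y × ¬ (Y ⊆ X)

Covers : ∀ {n} → (Subset n → Set) → Subset n → Subset n → Set
Covers {n} F X Y = X ⊂ Y × (∀ (Z : Subset n) → F Z → X ⊂ Z → ¬ (Z ⊂ Y))

-- Acyclicity means every implication across the split points from U₁ into U₂ = ∁ U₁, so
-- C₁ ∪ X is closed as soon as X ∈ 𝒞₂ and the crossing implications fired by C₁ land in X;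
-- enlarging the U₂-part from C₂ to C₂′ keeps this true. The covering claim needs no
-- acyclicity: the trace Z ∩ U₂ of a closed Z strictly between C₁ ∪ C₂ and C₁ ∪ C₂′ lies
-- in 𝒞₂ strictly between C₂ and C₂′.
module Submission where

open import Defs
open import Data.Nat using (ℕ)
open import Data.Fin.Subset using (Subset; _∈_; _⊆_; _∪_; _∩_; ∁)
open import Data.Fin.Subset.Properties
  using (_∈?_; ⊆-trans; x∈∁p⇒x∉p; x∉p⇒x∈∁p; p⊆p∪q; q⊆p∪q; x∈p∪q⁺; x∈p∪q⁻; p∩q⊆p; p∩q⊆q; x∈p∩q⁺)
open import Data.Product using (_×_; _,_; proj₁; proj₂; uncurry)
open import Data.Sum using (inj₁; inj₂; [_,_]′; map₂)
open import Data.Empty using (⊥-elim)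
open import Relation.Nullary using (¬_; yes; no)
open import Data.List.Membership.Propositional using () renaming (_∈_ to _∈ₗ_)

module _ {n : ℕ} where

  ∪-least : ∀ {X Y Z : Subset n} → X ⊆ Z → Y ⊆ Z → X ∪ Y ⊆ Z
  ∪-least {X} {Y} X⊆Z Y⊆Z x∈X∪Y = [ X⊆Z , Y⊆Z ]′ (x∈p∪q⁻ X Y x∈X∪Y)

  ∪-monoʳ-⊆ : ∀ {C X Y : Subset n} → X ⊆ Y → C ∪ X ⊆ C ∪ Y
  ∪-monoʳ-⊆ {C} {X} X⊆Y x∈C∪X = x∈p∪q⁺ (map₂ X⊆Y (x∈p∪q⁻ C X x∈C∪X))

module _ {n : ℕ} {U : Subset n} where

  ∪-∈ʳ : ∀ {C X x} → C ⊆ U → x ∈ C ∪ X → x ∈ ∁ U → x ∈ X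
  ∪-∈ʳ {C} {X} C⊆U x∈C∪X x∈∁U with x∈p∪q⁻ C X x∈C∪X
  ... | inj₁ x∈C = ⊥-elim (x∈∁p⇒x∉p x∈∁U (C⊆U x∈C))
  ... | inj₂ x∈X = x∈X

  ∪-∈ˡ : ∀ {C X x} → X ⊆ ∁ U → x ∈ C ∪ X → x ∈ U → x ∈ C
  ∪-∈ˡ {C} {X} X⊆∁U x∈C∪X x∈U with x∈p∪q⁻ C X x∈C∪X
  ... | inj₁ x∈C = x∈C
  ... | inj₂ x∈X = ⊥-elim (x∈∁p⇒x∉p (X⊆∁U x∈X) x∈U)

  ∪-⊆ˡ : ∀ {A C X} → X ⊆ ∁ U → A ⊆ C ∪ X → A ⊆ U → A ⊆ C
  ∪-⊆ˡ X⊆∁U A⊆C∪X A⊆U x∈A = ∪-∈ˡ X⊆∁U (A⊆C∪X x∈A) (A⊆U x∈A)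

  ∪-reflects-⊆ʳ : ∀ {C X Y} → C ⊆ U → X ⊆ ∁ U → C ∪ X ⊆ C ∪ Y → X ⊆ Y
  ∪-reflects-⊆ʳ {C} {X} C⊆U X⊆∁U C∪X⊆C∪Y x∈X =
    ∪-∈ʳ C⊆U (C∪X⊆C∪Y (q⊆p∪q C X x∈X)) (X⊆∁U x∈X)

  ∪-monoʳ-⊂ : ∀ {C X Y} → C ⊆ U → Y ⊆ ∁ U → X ⊂ Y → (C ∪ X) ⊂ (C ∪ Y)
  ∪-monoʳ-⊂ C⊆U Y⊆∁U (X⊆Y , Y⊈X) =
    ∪-monoʳ-⊆ X⊆Y , λ C∪Y⊆C∪X → Y⊈X (∪-reflects-⊆ʳ C⊆U Y⊆∁U C∪Y⊆C∪X)

  ⊆-∪-∩∁ : ∀ {C Y Z} → Y ⊆ ∁ U → Z ⊆ C ∪ Y → Z ⊆ C ∪ (Z ∩ ∁ U)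
  ⊆-∪-∩∁ {C} Y⊆∁U Z⊆C∪Y {x} x∈Z with x ∈? U
  ... | yes x∈U = p⊆p∪q _ (∪-∈ˡ Y⊆∁U (Z⊆C∪Y x∈Z) x∈U)
  ... | no  x∉U = q⊆p∪q C _ (x∈p∩q⁺ (x∈Z , x∉p⇒x∈∁p x∉U))

  ∩∁-between : ∀ {C X Y Z} → C ⊆ U → X ⊆ ∁ U → Y ⊆ ∁ U →
    (C ∪ X) ⊂ Z → Z ⊂ (C ∪ Y) → X ⊂ (Z ∩ ∁ U) × (Z ∩ ∁ U) ⊂ Y
  ∩∁-between {C} {X} {Y} {Z} C⊆U X⊆∁U Y⊆∁U (C∪X⊆Z , Z⊈C∪X) (Z⊆C∪Y , C∪Y⊈Z) =
    (X⊆Z∩∁U , λ Z∩∁U⊆X → Z⊈C∪X (⊆-trans (⊆-∪-∩∁ Y⊆∁U Z⊆C∪Y) (∪-monoʳ-⊆ Z∩∁U⊆X))) ,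
    (Z∩∁U⊆Y , λ Y⊆Z∩∁U → C∪Y⊈Z (∪-least C⊆Z (⊆-trans Y⊆Z∩∁U Z∩∁U⊆Z)))
    where
    Z∩∁U⊆Z : Z ∩ ∁ U ⊆ Z
    Z∩∁U⊆Z = p∩q⊆p Z (∁ U)
    C⊆Z : C ⊆ Z
    C⊆Z = ⊆-trans (p⊆p∪q X) C∪X⊆Z
    X⊆Z∩∁U : X ⊆ Z ∩ ∁ U
    X⊆Z∩∁U x∈X = x∈p∩q⁺ (C∪X⊆Z (q⊆p∪q C X x∈X) , X⊆∁U x∈X)
    Z∩∁U⊆Y : Z ∩ ∁ U ⊆ Y
    Z∩∁U⊆Y x∈Z∩∁U = ∪-∈ʳ C⊆U (Z⊆C∪Y (Z∩∁U⊆Z x∈Z∩∁U)) (p∩q⊆q Z (∁ U) x∈Z∩∁U)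

∩-closedOn : ∀ {n} {Σ' : Base n} {X Z : Subset n} → InClosure Σ' Z → InClosureOn Σ' X (Z ∩ X)
∩-closedOn {X = X} {Z} Z-closed =
  p∩q⊆q Z X ,
  λ (i∈Σ , _ , b∈X) A⊆Z∩X → x∈p∩q⁺ (Z-closed i∈Σ (⊆-trans A⊆Z∩X (p∩q⊆p Z X)) , b∈X)

premise⊆U⇒premise⊈∁U : ∀ {n} {U : Subset n} (i : Implication n) →
  premise i ⊆ U → ¬ (premise i ⊆ ∁ U)
premise⊆U⇒premise⊈∁U i A⊆U A⊆∁U = x∈∁p⇒x∉p (A⊆∁U a∈A) (A⊆U a∈A)
  where a∈A = proj₂ (premise-ne i)

data Placement {n : ℕ} (U : Subset n) (i : Implication n) : Set where
  within   : premise i ⊆ U   → conclusion i ∈ U   → Placement U i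
  withinᶜ  : premise i ⊆ ∁ U → conclusion i ∈ ∁ U → Placement U i
  crossing : premise i ⊆ U   → conclusion i ∈ ∁ U → Placement U i

placement : ∀ {n} {Σ' : Base n} {U₁ : Subset n} {i : Implication n} →
  IsAcyclicSplit Σ' U₁ → i ∈ₗ Σ' → Placement U₁ i
placement {U₁ = U₁} {i} ((_ , _ , premise-sided) , acyclic) i∈Σ
  with premise-sided i∈Σ | conclusion i ∈? U₁
... | inj₁ A⊆U₁  | yes b∈U₁ = within A⊆U₁ b∈U₁
... | inj₁ A⊆U₁  | no  b∉U₁ = crossing A⊆U₁ (x∉p⇒x∈∁p b∉U₁)
... | inj₂ A⊆∁U₁ | no  b∉U₁ = withinᶜ A⊆∁U₁ (x∉p⇒x∈∁p b∉U₁)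
... | inj₂ A⊆∁U₁ | yes b∈U₁ = ⊥-elim (premise⊆U⇒premise⊈∁U i A⊆U₁ A⊆∁U₁)
  where
  A⊆U₁ : premise i ⊆ U₁
  A⊆U₁ = acyclic ( i∈Σ
                 , (λ (_ , A⊆U₁ , _) → premise⊆U⇒premise⊈∁U i A⊆U₁ A⊆∁U₁)
                 , (λ (_ , _ , b∈∁U₁) → x∈∁p⇒x∉p b∈∁U₁ b∈U₁))

module _ {n : ℕ} {Σ' : Base n} {U₁ C₁ C₂ C₂′ : Subset n} where

  ∪-closed-monoʳ : IsAcyclicSplit Σ' U₁ → InClosureOn Σ' U₁ C₁ → InClosureOn Σ' (∁ U₁) C₂′ →
    C₂ ⊆ C₂′ → InClosure Σ' (C₁ ∪ C₂) → InClosure Σ' (C₁ ∪ C₂′)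
  ∪-closed-monoʳ acyclic (C₁⊆U₁ , C₁-closed) (C₂′⊆∁U₁ , C₂′-closed) C₂⊆C₂′ C₁∪C₂-closed
                 {i} i∈Σ A⊆C₁∪C₂′ with placement acyclic i∈Σ
  ... | within A⊆U₁ b∈U₁ =
    p⊆p∪q C₂′ (C₁-closed (i∈Σ , A⊆U₁ , b∈U₁) (∪-⊆ˡ C₂′⊆∁U₁ A⊆C₁∪C₂′ A⊆U₁))
  ... | withinᶜ A⊆∁U₁ b∈∁U₁ =
    q⊆p∪q C₁ C₂′ (C₂′-closed (i∈Σ , A⊆∁U₁ , b∈∁U₁)
                             (λ x∈A → ∪-∈ʳ C₁⊆U₁ (A⊆C₁∪C₂′ x∈A) (A⊆∁U₁ x∈A)))
  ... | crossing A⊆U₁ _ =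
    ∪-monoʳ-⊆ C₂⊆C₂′ (C₁∪C₂-closed i∈Σ (⊆-trans (∪-⊆ˡ C₂′⊆∁U₁ A⊆C₁∪C₂′ A⊆U₁) (p⊆p∪q C₂)))

  ∪-coversʳ : C₁ ⊆ U₁ → C₂ ⊆ ∁ U₁ → C₂′ ⊆ ∁ U₁ →
    Covers (InClosureOn Σ' (∁ U₁)) C₂ C₂′ → Covers (InClosure Σ') (C₁ ∪ C₂) (C₁ ∪ C₂′)
  ∪-coversʳ C₁⊆U₁ C₂⊆∁U₁ C₂′⊆∁U₁ (C₂⊂C₂′ , nothing-between) =
    ∪-monoʳ-⊂ C₁⊆U₁ C₂′⊆∁U₁ C₂⊂C₂′ ,
    λ Z Z-closed C₁∪C₂⊂Z Z⊂C₁∪C₂′ →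
      uncurry (nothing-between (Z ∩ ∁ U₁) (∩-closedOn Z-closed))
              (∩∁-between C₁⊆U₁ C₂⊆∁U₁ C₂′⊆∁U₁ C₁∪C₂⊂Z Z⊂C₁∪C₂′)

corollary2 : ∀ {n : ℕ} (Σ' : Base n) (U₁ : Subset n) →
    IsAcyclicSplit Σ' U₁ →
    (C₂ C₂′ C₁ : Subset n) →
    InClosureOn Σ' (∁ U₁) C₂ →
    InClosureOn Σ' (∁ U₁) C₂′ →
    Covers (InClosureOn Σ' (∁ U₁)) C₂ C₂′ →
    InClosureOn Σ' U₁ C₁ →
    InClosure Σ' (C₁ ∪ C₂) →
    InClosure Σ' (C₁ ∪ C₂′) × Covers (InClosure Σ') (C₁ ∪ C₂) (C₁ ∪ C₂′)
corollary2 Σ' U₁ acyclic C₂ C₂′ C₁ (C₂⊆∁U₁ , _) C₂′∈𝒞₂ cover C₁∈𝒞₁ C₁∪C₂-closed =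
  ∪-closed-monoʳ acyclic C₁∈𝒞₁ C₂′∈𝒞₂ (proj₁ (proj₁ cover)) C₁∪C₂-closed ,
  ∪-coversʳ (proj₁ C₁∈𝒞₁) C₂⊆∁U₁ (proj₁ C₂′∈𝒞₂) cover
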